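{- Let $(S,\sqcup,\cap)$ be an ado-semilattice and set $a\curlyvee b=(a\sqcup b)\cap(b\sqcup a)$. Then for all $a,b,c,d\in S$: (1) if $d\lesssim a\cap b$ and $d\lesssim b\cap c$, then $d\lesssim a\cap c$; (2) if $d\lesssim a$, $d\lesssim b$ and $d\lesssim a\curlyvee b$, then $d\lesssim a\cap b$.
   Context: An ado-semilattice is an algebra $(S,\sqcup,\cap)$ such that $(S,\cap)$ is a semilattice and, writing $x\le y$ iff $x=x\cap y$, for all $x,y,z,d$: (i) $x\le x\sqcup y$; (ii) $(x\cap y)\sqcup(y\cap z)\le y$; (iii) $x\sqcup y\le x\sqcup(y\cap(x\sqcup y))$; (iv) $x\cap z\le(x\cap y)\sqcup z$; (v) $(x\cap d)\sqcup((y\cap d)\cap(z\cap d))=((x\cap d)\sqcup(y\cap d))\cap((x\cap d)\sqcup(z\cap d))$; (vi) $\sqcup$ is associative. The relation $x\lesssim y$ means $y\sqcup x=y$. -}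

module Defs where

open import Level using (Level; suc)
open import Relation.Binary.PropositionalEquality using (_≡_)
open import Algebra.Core using (Op₂)
open import Algebra.Lattice.Structures using (IsSemilattice)

record AdoSemilattice (c : Level) : Set (suc c) where
  infixr 6 _⊔_
  infixr 7 _∩_
  infix 4 _≤_ _≲_
  field
    S   : Set c
    _⊔_ : Op₂ S
    _∩_ : Op₂ S

  _≤_ : S → S → Set c
  x ≤ y = x ≡ x ∩ y

  _≲_ : S → S → Set c
  x ≲ y = y ⊔ x ≡ y

  field
    ∩-isSemilattice : IsSemilattice _≡_ _∩_
    ax-i   : ∀ x y → x ≤ x ⊔ y
    ax-ii  : ∀ x y z → (x ∩ y) ⊔ (y ∩ z) ≤ y
    ax-iii : ∀ x y → x ⊔ y ≤ x ⊔ (y ∩ (x ⊔ y))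
    ax-iv  : ∀ x y z → x ∩ z ≤ (x ∩ y) ⊔ z
    ax-v   : ∀ x y z d →
      (x ∩ d) ⊔ ((y ∩ d) ∩ (z ∩ d)) ≡ ((x ∩ d) ⊔ (y ∩ d)) ∩ ((x ∩ d) ⊔ (z ∩ d))
    ⊔-assoc : ∀ x y z → (x ⊔ y) ⊔ z ≡ x ⊔ (y ⊔ z)

  _⋎_ : S → S → S
  a ⋎ b = (a ⊔ b) ∩ (b ⊔ a)

-- Below a common upper bound z the operation ⊔ is the join of the order ≤ and
-- distributes over ∩ (axioms (ii), (iv), (v)), and there ≲ coincides with ≤.
-- The heart of the proof is that ≲ is closed under meets of elements x, y ≤ z:
-- for w = (x ∩ y) ⊔ d one tests w against z° = z ∩ (w ⊔ z), which by axiom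
-- (iii) and distributivity satisfies z° ⊔ (x ∩ y) = z.  Hence z ≤ w ⊔ z, so
-- w ⊔ z = z ⊔ w = z, i.e. w ≤ z, and then w ≤ x ∩ y.  Part (1) uses this with
-- z = b, part (2) twice, with z = a ⊔ b and z = b ⊔ a; both finish because ≲
-- is transitive and contains ≤.
module Submission where

open import Defs
open import Level using (Level)
open import Data.Product using (_×_; _,_)
open import Relation.Binary.PropositionalEquality
open import Algebra.Lattice.Bundles using (Semilattice)
open import Algebra.Lattice.Properties.Semilattice using (∧-orderTheoreticMeetSemilattice)
open import Relation.Binary.Lattice using (MeetSemilattice)

module AdoSemilatticeProperties {ℓ : Level} (A : AdoSemilattice ℓ) where
  open AdoSemilattice A
  open ≡-Reasoning

  ∩-semilattice : Semilattice ℓ ℓ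
  ∩-semilattice = record { isSemilattice = ∩-isSemilattice }

  open Semilattice ∩-semilattice using (comm; idem)

  -- The library orders a semilattice by x ≈ x ∧ y, which is literally _≤_.
  open MeetSemilattice (∧-orderTheoreticMeetSemilattice ∩-semilattice)
    using ()
    renaming ( antisym to ≤-antisym; trans to ≤-trans; refl to ≤-refl
             ; x∧y≤x to x∩y≤x; x∧y≤y to x∩y≤y; ∧-greatest to ∩-greatest )

  x≤y⇒y∩x≡x : ∀ {x y} → x ≤ y → y ∩ x ≡ x
  x≤y⇒y∩x≡x {x} {y} x≤y = trans (comm y x) (sym x≤y)

  ⊔-least : ∀ {x y z} → x ≤ z → y ≤ z → x ⊔ y ≤ z
  ⊔-least {x} {y} {z} x≤z y≤z =
    subst (_≤ z) (cong₂ _⊔_ (sym x≤z) (x≤y⇒y∩x≡x y≤z)) (ax-ii x z y)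

  y≤x⊔y : ∀ {x y z} → x ≤ z → y ≤ z → y ≤ x ⊔ y
  y≤x⊔y {x} {y} {z} x≤z y≤z =
    subst₂ (λ u v → u ≤ v ⊔ y) (x≤y⇒y∩x≡x y≤z) (x≤y⇒y∩x≡x x≤z)
      (ax-iv z x y)

  ⊔-comm-below : ∀ {x y z} → x ≤ z → y ≤ z → x ⊔ y ≡ y ⊔ x
  ⊔-comm-below x≤z y≤z = ≤-antisym
    (⊔-least (y≤x⊔y y≤z x≤z) (ax-i _ _))
    (⊔-least (y≤x⊔y x≤z y≤z) (ax-i _ _))

  x≤y⇒x⊔y≡y : ∀ {x y} → x ≤ y → x ⊔ y ≡ y
  x≤y⇒x⊔y≡y x≤y = ≤-antisym (⊔-least x≤y ≤-refl) (y≤x⊔y x≤y ≤-refl)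

  ≤⇒≲ : ∀ {x y} → x ≤ y → x ≲ y
  ≤⇒≲ {y = y} x≤y = ≤-antisym (⊔-least ≤-refl x≤y) (ax-i y _)

  ≲⇒≤-below : ∀ {x y z} → x ≤ z → y ≤ z → x ≲ y → x ≤ y
  ≲⇒≤-below {x} {y} {z} x≤z y≤z x≲y =
    subst₂ _≤_ (x≤y⇒y∩x≡x x≤z) (trans (cong (_⊔ x) (x≤y⇒y∩x≡x y≤z)) x≲y)
      (ax-iv z y x)

  ≲-trans : ∀ {x y z} → x ≲ y → y ≲ z → x ≲ z
  ≲-trans {x} {y} {z} x≲y y≲z = begin
    z ⊔ x        ≡⟨ cong (_⊔ x) (sym y≲z) ⟩
    (z ⊔ y) ⊔ x  ≡⟨ ⊔-assoc z y x ⟩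
    z ⊔ (y ⊔ x)  ≡⟨ cong (z ⊔_) x≲y ⟩
    z ⊔ y        ≡⟨ y≲z ⟩
    z            ∎

  ⊔-≲ : ∀ {x y z} → x ≲ z → y ≲ z → x ⊔ y ≲ z
  ⊔-≲ {x} {y} {z} x≲z y≲z = begin
    z ⊔ (x ⊔ y)  ≡⟨ sym (⊔-assoc z x y) ⟩
    (z ⊔ x) ⊔ y  ≡⟨ cong (_⊔ y) x≲z ⟩
    z ⊔ y        ≡⟨ y≲z ⟩
    z            ∎

  x⊔[y∩x⊔y]≡x⊔y : ∀ x y → x ⊔ (y ∩ (x ⊔ y)) ≡ x ⊔ y
  x⊔[y∩x⊔y]≡x⊔y x y = ≤-antisym (⊔-least (ax-i x y) (x∩y≤y y (x ⊔ y))) (ax-iii x y)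

  ⊔-distribˡ-∩-below : ∀ {r x y z} → r ≤ z → x ≤ z → y ≤ z →
                       r ⊔ (x ∩ y) ≡ (r ⊔ x) ∩ (r ⊔ y)
  ⊔-distribˡ-∩-below {r} {x} {y} {z} r≤z x≤z y≤z = begin
    r ⊔ (x ∩ y)
      ≡⟨ cong₂ _⊔_ r≤z (cong₂ _∩_ x≤z y≤z) ⟩
    (r ∩ z) ⊔ ((x ∩ z) ∩ (y ∩ z))
      ≡⟨ ax-v r x y z ⟩
    ((r ∩ z) ⊔ (x ∩ z)) ∩ ((r ∩ z) ⊔ (y ∩ z))
      ≡⟨ sym (cong₂ _∩_ (cong₂ _⊔_ r≤z x≤z) (cong₂ _⊔_ r≤z y≤z)) ⟩
    (r ⊔ x) ∩ (r ⊔ y) ∎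

  ≲-both⇒≤-bound : ∀ {x y z w} → x ≤ z → y ≤ z →
                   w ≲ x → w ≲ y → x ∩ y ≤ w → w ≤ z
  ≲-both⇒≤-bound {x} {y} {z} {w} x≤z y≤z w≲x w≲y x∩y≤w = subst (w ≤_) w⊔z≡z (ax-i w z)
    where
    z° : S
    z° = z ∩ (w ⊔ z)

    z°≤z : z° ≤ z
    z°≤z = x∩y≤x z (w ⊔ z)

    z°-complements : ∀ {u} → u ≤ z → w ≲ u → z° ⊔ u ≡ z
    z°-complements {u} u≤z w≲u = begin
      z° ⊔ u        ≡⟨ ⊔-comm-below z°≤z u≤z ⟩
      u ⊔ z°        ≡⟨ cong (_⊔ z°) (sym w≲u) ⟩
      (u ⊔ w) ⊔ z°  ≡⟨ ⊔-assoc u w z° ⟩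
      u ⊔ (w ⊔ z°)  ≡⟨ cong (u ⊔_) (x⊔[y∩x⊔y]≡x⊔y w z) ⟩
      u ⊔ (w ⊔ z)   ≡⟨ sym (⊔-assoc u w z) ⟩
      (u ⊔ w) ⊔ z   ≡⟨ cong (_⊔ z) w≲u ⟩
      u ⊔ z         ≡⟨ x≤y⇒x⊔y≡y u≤z ⟩
      z             ∎

    z°⊔x∩y≡z : z° ⊔ (x ∩ y) ≡ z
    z°⊔x∩y≡z = begin
      z° ⊔ (x ∩ y)         ≡⟨ ⊔-distribˡ-∩-below z°≤z x≤z y≤z ⟩
      (z° ⊔ x) ∩ (z° ⊔ y)  ≡⟨ cong₂ _∩_ (z°-complements x≤z w≲x) (z°-complements y≤z w≲y) ⟩
      z ∩ z                ≡⟨ idem z ⟩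
      z                    ∎

    z≤w⊔z : z ≤ w ⊔ z
    z≤w⊔z = subst (_≤ w ⊔ z) z°⊔x∩y≡z
      (⊔-least (x∩y≤y z (w ⊔ z)) (≤-trans x∩y≤w (ax-i w z)))

    w⊔z≡z : w ⊔ z ≡ z
    w⊔z≡z = trans (⊔-comm-below (ax-i w z) z≤w⊔z) (≲-trans w≲x (≤⇒≲ x≤z))

  ≲-∩-below : ∀ {x y z d} → x ≤ z → y ≤ z → d ≲ x → d ≲ y → d ≲ x ∩ y
  ≲-∩-below {x} {y} {z} {d} x≤z y≤z d≲x d≲y = ≤-antisym w≤x∩y (ax-i (x ∩ y) d)
    where
    w≲ : ∀ {u} → x ∩ y ≤ u → d ≲ u → (x ∩ y) ⊔ d ≲ u
    w≲ x∩y≤u d≲u = ⊔-≲ (≤⇒≲ x∩y≤u) d≲u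

    w≲x : (x ∩ y) ⊔ d ≲ x
    w≲x = w≲ (x∩y≤x x y) d≲x

    w≲y : (x ∩ y) ⊔ d ≲ y
    w≲y = w≲ (x∩y≤y x y) d≲y

    w≤z : (x ∩ y) ⊔ d ≤ z
    w≤z = ≲-both⇒≤-bound x≤z y≤z w≲x w≲y (ax-i (x ∩ y) d)

    w≤x∩y : (x ∩ y) ⊔ d ≤ x ∩ y
    w≤x∩y = ∩-greatest (≲⇒≤-below w≤z x≤z w≲x) (≲⇒≤-below w≤z y≤z w≲y)

  ≲-∩-trans : ∀ {a b c d} → d ≲ a ∩ b → d ≲ b ∩ c → d ≲ a ∩ c
  ≲-∩-trans {a} {b} {c} d≲a∩b d≲b∩c =
    ≲-trans (≲-∩-below (x∩y≤y a b) (x∩y≤x b c) d≲a∩b d≲b∩c) (≤⇒≲ [a∩b]∩[b∩c]≤a∩c)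
    where
    [a∩b]∩[b∩c]≤a∩c : (a ∩ b) ∩ (b ∩ c) ≤ a ∩ c
    [a∩b]∩[b∩c]≤a∩c = ∩-greatest (≤-trans (x∩y≤x _ _) (x∩y≤x a b))
                                 (≤-trans (x∩y≤y _ _) (x∩y≤y b c))

  ≲-⋎⇒≲-∩ : ∀ {a b d} → d ≲ a → d ≲ b → d ≲ a ⋎ b → d ≲ a ∩ b
  ≲-⋎⇒≲-∩ {a} {b} {d} d≲a d≲b d≲a⋎b = ≲-trans d≲[a⋎b∩a]∩b (≤⇒≲ [a⋎b∩a]∩b≤a∩b)
    where
    d≲a⋎b∩a : d ≲ (a ⋎ b) ∩ a
    d≲a⋎b∩a = ≲-∩-below (x∩y≤x (a ⊔ b) (b ⊔ a)) (ax-i a b) d≲a⋎b d≲a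

    d≲[a⋎b∩a]∩b : d ≲ ((a ⋎ b) ∩ a) ∩ b
    d≲[a⋎b∩a]∩b = ≲-∩-below (≤-trans (x∩y≤x _ a) (x∩y≤y (a ⊔ b) (b ⊔ a))) (ax-i b a)
      d≲a⋎b∩a d≲b

    [a⋎b∩a]∩b≤a∩b : ((a ⋎ b) ∩ a) ∩ b ≤ a ∩ b
    [a⋎b∩a]∩b≤a∩b = ∩-greatest (≤-trans (x∩y≤x _ b) (x∩y≤y _ a)) (x∩y≤y _ b)

lemma3p6 : ∀ {ℓ : Level} (A : AdoSemilattice ℓ) → let open AdoSemilattice A in
    ∀ (a b c d : S) →
      ((d ≲ a ∩ b) → (d ≲ b ∩ c) → (d ≲ a ∩ c))
      × ((d ≲ a) → (d ≲ b) → (d ≲ a ⋎ b) → (d ≲ a ∩ b))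
lemma3p6 A a b c d = ≲-∩-trans , ≲-⋎⇒≲-∩
  where open AdoSemilatticeProperties A
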